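{- Let $G$ be a connected graph and let $\varepsilon(G)$ be the number of vertices of degree one in $G$. If every vertex of $G$ of degree greater than one is a cut vertex of $G$, then $G_{SR}\cong K_{\varepsilon(G)}$.
   Context: All graphs are finite, simple and undirected; $d_G$ is the distance in $G$. A cut vertex is a vertex whose removal increases the number of connected components. A vertex $u$ is maximally distant from $v$ if $d_G(v,w)\le d_G(u,v)$ for every neighbor $w$ of $u$. Vertices $u,v$ are mutually maximally distant (MMD) if each is maximally distant from the other. The boundary $\partial(G)$ is the set of vertices maximally distant from some vertex of $G$. The strong resolving graph $G_{SR}$ has vertex set $\partial(G)$, two vertices being adjacent iff they are MMD in $G$. $K_m$ is the complete graph on $m$ vertices. -}

module Defs where

open import Data.Nat using (ℕ; zero; suc; _≤_; _+_)
open import Data.Fin using (Fin)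
open import Data.Bool using (Bool; true; false)
open import Data.List using (List; length; filter; allFin)
open import Data.Product using (Σ; ∃; _×_; _,_)
open import Relation.Binary.PropositionalEquality using (_≡_; _≢_)
open import Relation.Nullary using (¬_)
open import Data.Bool.Properties using (_≟_)

record Graph (n : ℕ) : Set where
  field
    adj       : Fin n → Fin n → Bool
    adj-sym   : ∀ u v → adj u v ≡ adj v u
    adj-irref : ∀ u → adj u u ≡ false
open Graph public

module _ {n : ℕ} (G : Graph n) where

  Adj : Fin n → Fin n → Set
  Adj u v = adj G u v ≡ true

  data Walk : Fin n → Fin n → ℕ → Set where
    nil  : ∀ u → Walk u u 0
    cons : ∀ {u w v k} → Adj u w → Walk w v k → Walk u v (suc k)

  data WalkAvoiding (x : Fin n) : Fin n → Fin n → Set where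
    nil  : ∀ u → u ≢ x → WalkAvoiding x u u
    cons : ∀ {u w v} → u ≢ x → Adj u w → WalkAvoiding x w v → WalkAvoiding x u v

  Connected : Set
  Connected = ∀ u v → ∃ λ k → Walk u v k

  Dist : Fin n → Fin n → ℕ → Set
  Dist u v k = Walk u v k × (∀ m → Walk u v m → k ≤ m)

  degree : Fin n → ℕ
  degree u = length (filter (λ w → adj G u w ≟ true) (allFin n))

  leaves : ℕ
  leaves = length (filter (λ u → degree u Data.Nat.≟ 1) (allFin n))

  -- removing x increases the number of connected components:
  -- some two vertices of G - x joined in G are no longer joined in G - x
  CutVertex : Fin n → Set
  CutVertex x = ∃ λ u → ∃ λ v → u ≢ x × v ≢ x × (∃ λ k → Walk u v k)
                × ¬ WalkAvoiding x u v

  MaxDistFrom : Fin n → Fin n → Set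
  MaxDistFrom u v = ∀ w k l → Adj u w → Dist v w k → Dist u v l → k ≤ l

  MMD : Fin n → Fin n → Set
  MMD u v = MaxDistFrom u v × MaxDistFrom v u

  InBoundary : Fin n → Set
  InBoundary u = ∃ λ v → MaxDistFrom u v

  -- adjacency of the strong resolving graph G_SR (on ∂(G); simple graph, so u ≠ v)
  AdjSR : Fin n → Fin n → Set
  AdjSR u v = u ≢ v × MMD u v

  -- G_SR ≅ K_m : a bijection f from Fin m onto ∂(G) with
  -- i ≠ j  ⇔  f i, f j adjacent in G_SR
  SRIsoComplete : ℕ → Set
  SRIsoComplete m = Σ (Fin m → Fin n) λ f →
      (∀ i j → f i ≡ f j → i ≡ j)
    × (∀ i → InBoundary (f i))
    × (∀ u → InBoundary u → ∃ λ i → f i ≡ u)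
    × (∀ i j → (i ≢ j → AdjSR (f i) (f j)) × (AdjSR (f i) (f j) → i ≢ j))

-- The boundary of G consists exactly of its leaves. A leaf is maximally
-- distant from every other vertex, because its unique neighbour lies on every
-- shortest path to it; hence any two distinct leaves are MMD and G_SR is
-- complete on the leaves. A vertex u of degree > 1 is a cut vertex, so for
-- any v some vertex is separated from v in G - u, and then so is the
-- neighbour y of u through which it reaches u; every v-y path passes through
-- u, so d(v,y) > d(v,u) and u is maximally distant from no v. Degree 0 is
-- excluded by connectivity and n ≥ 2.
module Submission where

open import Defs
open import Data.Nat using (ℕ; zero; suc; _≤_; _<_; z≤n; s≤s; _≟_)
open import Data.Nat.Properties
  using (≤-trans; <-≤-trans; ≤-<-trans; <-irrefl; n≤1+n; ≮⇒≥; anyUpTo?)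
open import Data.Nat.Induction using (<-rec)
open import Data.Fin using (Fin) renaming (zero to fzero; suc to fsuc)
import Data.Fin.Properties as Fin
open import Data.Bool using (true)
import Data.Bool.Properties as Bool
open import Data.List using (List; []; _∷_; length; filter; allFin; lookup)
open import Data.List.Membership.Propositional using (_∈_)
open import Data.List.Membership.Propositional.Properties
  using (∈-filter⁺; ∈-filter⁻; ∈-lookup; ∈-allFin; ∈-length)
open import Data.List.Relation.Unary.Any using (here; index)
open import Data.List.Relation.Unary.Any.Properties using (lookup-index)
import Data.List.Relation.Unary.All as All
open import Data.List.Relation.Unary.AllPairs using (_∷_)
open import Data.List.Relation.Unary.Unique.Propositional using (Unique)
import Data.List.Relation.Unary.Unique.Propositional.Properties as Unique
open import Data.Product using (∃; _×_; _,_; proj₁; proj₂)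
open import Data.Empty using (⊥-elim)
open import Relation.Nullary using (¬_; Dec; yes; no)
open import Relation.Nullary.Decidable using (_×-dec_)
open import Relation.Unary using (Decidable)
open import Function using (_∘_)
open import Relation.Binary.PropositionalEquality using (_≡_; _≢_; refl; sym; trans; cong)

least-witness : {P : ℕ → Set} → Decidable P → ∀ k → P k
              → ∃ λ m → P m × (∀ j → P j → m ≤ j)
least-witness {P} P? = <-rec _ search
  where
    search : ∀ k → (∀ {j} → j < k → P j → ∃ λ m → P m × (∀ i → P i → m ≤ i))
           → P k → ∃ λ m → P m × (∀ i → P i → m ≤ i)
    search k smaller pk with anyUpTo? P? k
    ... | yes (j , j<k , pj) = smaller j<k pj
    ... | no none = k , pk , λ j pj → ≮⇒≥ (λ j<k → none (j , j<k , pj))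

lookup-injective : ∀ {A : Set} {xs : List A} → Unique xs
                 → ∀ i j → lookup xs i ≡ lookup xs j → i ≡ j
lookup-injective (_ ∷ _)  fzero    fzero    _ = refl
lookup-injective (x∉ ∷ _) fzero    (fsuc j) e = ⊥-elim (All.lookup x∉ (∈-lookup j) e)
lookup-injective (x∉ ∷ _) (fsuc i) fzero    e = ⊥-elim (All.lookup x∉ (∈-lookup i) (sym e))
lookup-injective (_ ∷ u)  (fsuc i) (fsuc j) e = cong fsuc (lookup-injective u i j e)

length≡1⇒∈-unique : ∀ {A : Set} {x y : A} {xs : List A}
                  → length xs ≡ 1 → x ∈ xs → y ∈ xs → x ≡ y
length≡1⇒∈-unique {xs = _ ∷ []} _ (here x≡z) (here y≡z) = trans x≡z (sym y≡z)

∃-other : ∀ {n} → 2 ≤ n → (u : Fin n) → ∃ λ v → u ≢ v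
∃-other (s≤s (s≤s _)) fzero    = fsuc fzero , λ ()
∃-other (s≤s (s≤s _)) (fsuc _) = fzero , λ ()

module _ {n : ℕ} (G : Graph n) where

  Adj? : ∀ u w → Dec (Adj G u w)
  Adj? u w = adj G u w Bool.≟ true

  Adj-sym : ∀ {u w} → Adj G u w → Adj G w u
  Adj-sym {u} {w} a = trans (adj-sym G w u) a

  _▷_ : ∀ {u v w k} → Walk G u v k → Adj G v w → Walk G u w (suc k)
  nil _    ▷ a = cons a (nil _)
  cons b p ▷ a = cons b (p ▷ a)

  reverse : ∀ {u v k} → Walk G u v k → Walk G v u k
  reverse (nil u)    = nil u
  reverse (cons a p) = reverse p ▷ Adj-sym a

  Walk? : ∀ k u v → Dec (Walk G u v k)
  Walk? zero u v with u Fin.≟ v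
  ... | yes refl = yes (nil u)
  ... | no u≢v   = no λ { (nil _) → u≢v refl }
  Walk? (suc k) u v with Fin.any? (λ w → Adj? u w ×-dec Walk? k w v)
  ... | yes (_ , a , p) = yes (cons a p)
  ... | no none         = no λ { (cons a p) → none (_ , a , p) }

  Walk⇒Dist : ∀ {u v k} → Walk G u v k → ∃ (Dist G u v)
  Walk⇒Dist {u} {v} {k} p = least-witness (λ j → Walk? j u v) k p

  avoiding-head : ∀ {x u v} → WalkAvoiding G x u v → u ≢ x
  avoiding-head (nil _ u≢x)    = u≢x
  avoiding-head (cons u≢x _ _) = u≢x

  avoiding-last : ∀ {x u v} → WalkAvoiding G x u v → v ≢ x
  avoiding-last (nil _ v≢x)  = v≢x
  avoiding-last (cons _ _ p) = avoiding-last p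

  _++ᵃ_ : ∀ {x u v w} → WalkAvoiding G x u v → WalkAvoiding G x v w → WalkAvoiding G x u w
  nil _ _    ++ᵃ q = q
  cons u≢x a p ++ᵃ q = cons u≢x a (p ++ᵃ q)

  reverseᵃ : ∀ {x u v} → WalkAvoiding G x u v → WalkAvoiding G x v u
  reverseᵃ (nil u u≢x)    = nil u u≢x
  reverseᵃ (cons u≢x a p) = reverseᵃ p ++ᵃ cons (avoiding-head p) (Adj-sym a) (nil _ u≢x)

  blocked-walk-meets : ∀ {x v w k} → Walk G v w k → ¬ WalkAvoiding G x v w → w ≢ x
                     → ∃ λ i → i < k × Walk G v x i
  blocked-walk-meets (nil v) blocked w≢x = ⊥-elim (blocked (nil v w≢x))
  blocked-walk-meets {x} {v} (cons a p) blocked w≢x with v Fin.≟ x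
  ... | yes refl = 0 , s≤s z≤n , nil _
  ... | no v≢x with blocked-walk-meets p (λ q → blocked (cons v≢x a q)) w≢x
  ... | i , i<k , q = suc i , s≤s i<k , cons a q

  first-approach : ∀ {x c k} → Walk G c x k → c ≢ x
                 → ∃ λ y → Adj G y x × WalkAvoiding G x c y
  first-approach (nil _) c≢x = ⊥-elim (c≢x refl)
  first-approach {x} {c} (cons {w = z} a p) c≢x with z Fin.≟ x
  ... | yes refl = c , a , nil c c≢x
  ... | no z≢x with first-approach p z≢x
  ... | y , y~x , q = y , y~x , cons c≢x a q

  Adj⇒degree>0 : ∀ {u w} → Adj G u w → 0 < degree G u
  Adj⇒degree>0 {u} {w} a = ∈-length (∈-filter⁺ (Adj? u) (∈-allFin w) a)

  leaf-neighbour-unique : ∀ {u w w′} → degree G u ≡ 1 → Adj G u w → Adj G u w′ → w ≡ w′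
  leaf-neighbour-unique {u} {w} {w′} deg a a′ =
    length≡1⇒∈-unique deg (∈-filter⁺ (Adj? u) (∈-allFin w) a)
                          (∈-filter⁺ (Adj? u) (∈-allFin w′) a′)

  leaf-maxDistFrom : ∀ {u v} → degree G u ≡ 1 → u ≢ v → MaxDistFrom G u v
  leaf-maxDistFrom deg u≢v w k l u~w _ (nil _ , _) = ⊥-elim (u≢v refl)
  leaf-maxDistFrom deg u≢v w k l u~w (_ , shortest) (cons a p , _)
    with leaf-neighbour-unique deg a u~w
  ... | refl = ≤-trans (shortest _ (reverse p)) (n≤1+n _)

  separated-neighbour⇒¬maxDistFrom : Connected G → ∀ {u v y} → Adj G y u → y ≢ u
                                   → ¬ WalkAvoiding G u v y → ¬ MaxDistFrom G u v
  separated-neighbour⇒¬maxDistFrom conn {u} {v} {y} y~u y≢u blocked maxDist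
    with Walk⇒Dist (proj₂ (conn v y)) | Walk⇒Dist (proj₂ (conn u v))
  ... | k , d[v,y] | l , d[u,v] with blocked-walk-meets (proj₁ d[v,y]) blocked y≢u
  ... | i , i<k , v⇝u =
    <-irrefl refl (≤-<-trans (proj₂ d[u,v] i (reverse v⇝u))
                             (<-≤-trans i<k (maxDist y k l (Adj-sym y~u) d[v,y] d[u,v])))

  maxDistFrom⇒avoiding-walks : Connected G → ∀ {u v} → MaxDistFrom G u v
                             → ∀ c → c ≢ u → ¬ ¬ WalkAvoiding G u v c
  maxDistFrom⇒avoiding-walks conn {u} maxDist c c≢u c-blocked
    with first-approach (proj₂ (conn c u)) c≢u
  ... | y , y~u , c⇝y = separated-neighbour⇒¬maxDistFrom conn y~u (avoiding-last c⇝y)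
                          (λ v⇝y → c-blocked (v⇝y ++ᵃ reverseᵃ c⇝y)) maxDist

  cutVertex⇒¬maxDistFrom : Connected G → ∀ {u} → CutVertex G u → ∀ v → ¬ MaxDistFrom G u v
  cutVertex⇒¬maxDistFrom conn {u} (a , b , a≢u , b≢u , _ , separated) v maxDist =
    reaches a a≢u λ v⇝a → reaches b b≢u λ v⇝b → separated (reverseᵃ v⇝a ++ᵃ v⇝b)
    where
      reaches : ∀ c → c ≢ u → ¬ ¬ WalkAvoiding G u v c
      reaches = maxDistFrom⇒avoiding-walks conn maxDist

  connected⇒degree>0 : 2 ≤ n → Connected G → ∀ u → 0 < degree G u
  connected⇒degree>0 two conn u with ∃-other two u
  ... | v , u≢v with conn u v
  ... | _ , nil _    = ⊥-elim (u≢v refl)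
  ... | _ , cons a _ = Adj⇒degree>0 a

  boundary⇒leaf : 2 ≤ n → Connected G → (∀ v → 1 < degree G v → CutVertex G v)
                → ∀ u → InBoundary G u → degree G u ≡ 1
  boundary⇒leaf two conn cut u (v , maxDist)
    with degree G u | connected⇒degree>0 two conn u | cut u
  ... | zero        | () | _
  ... | 1           | _  | _     = refl
  ... | suc (suc _) | _  | cut-u =
    ⊥-elim (cutVertex⇒¬maxDistFrom conn (cut-u (s≤s (s≤s z≤n))) v maxDist)

  leaf⇒boundary : 2 ≤ n → ∀ u → degree G u ≡ 1 → InBoundary G u
  leaf⇒boundary two u deg with ∃-other two u
  ... | v , u≢v = v , leaf-maxDistFrom deg u≢v

proposition13 : (n : ℕ) → 2 ≤ n → (G : Graph n) → Connected G
    → (∀ (v : Fin n) → 1 < degree G v → CutVertex G v)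
    → SRIsoComplete G (leaves G)
proposition13 n two G conn cut = leaf , injective , leaf⇒boundary G two _ ∘ isLeaf , onto , mmd
  where
    isLeaf? : ∀ u → Dec (degree G u ≡ 1)
    isLeaf? u = degree G u ≟ 1

    leafList : List (Fin n)
    leafList = filter isLeaf? (allFin n)

    leaf : Fin (leaves G) → Fin n
    leaf = lookup leafList

    injective : ∀ i j → leaf i ≡ leaf j → i ≡ j
    injective = lookup-injective (Unique.filter⁺ isLeaf? (Unique.allFin⁺ n))

    isLeaf : ∀ i → degree G (leaf i) ≡ 1
    isLeaf i = proj₂ (∈-filter⁻ isLeaf? {xs = allFin n} (∈-lookup i))

    onto : ∀ u → InBoundary G u → ∃ λ i → leaf i ≡ u
    onto u bd = index u∈ , sym (lookup-index u∈)
      where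
        u∈ : u ∈ leafList
        u∈ = ∈-filter⁺ isLeaf? (∈-allFin u) (boundary⇒leaf G two conn cut u bd)

    mmd : ∀ i j → (i ≢ j → AdjSR G (leaf i) (leaf j)) × (AdjSR G (leaf i) (leaf j) → i ≢ j)
    mmd i j = (λ i≢j → let distinct = λ e → i≢j (injective i j e) in
                 distinct , leaf-maxDistFrom G (isLeaf i) distinct
                          , leaf-maxDistFrom G (isLeaf j) (λ e → distinct (sym e)))
            , λ { (distinct , _) refl → distinct refl }
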